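{- Let $\mathcal{G}=(G_0,G_1,\dots,G_q)$ be a $D$-acyclic $q$-colouring of a graph $G=(V,E)$, and let $\sigma=\sigma_{\mathcal{G}}$ be its GE-surplus. Then $\varnothing$ is $\sigma$-maximal (so it is the only $\sigma$-maximal set); equivalently, $\sigma(S)<0$ for every nonempty $S\subseteq V$.
   Context: A $q$-colouring of $G=(V,E)$ here is a tuple $(G_0,G_1,\dots,G_q)$ of graphs $G_j=(V,E_j)$ with $\bigcup_j E_j=E$, where $G_0$ consists of uncoloured edges. The Gallai--Edmonds decomposition $\mathsf{GE}(H)=(C,A,D)$ of a graph $H$: $D$ is the set of vertices missed by some maximum matching, $A$ the set of vertices outside $D$ adjacent to some vertex of $D$, $C$ the rest. For $j\in[q]$ write $\mathsf{GE}(G_j)=(C_j,A_j,D_j)$ and let $K_j^1,\dots,K_j^{\iota_j}$ be the vertex sets of the nontrivial (more than one vertex) connected components of $G_j[D_j]$. Let $\mathcal{K}=(V,\{K_j^i\})$; if this family is empty, instead $\mathcal{K}=(V,\{\{v\}\})$ for some fixed $v\in V$. Let $\mathcal{A}=(V,\{A_1,\dots,A_q\})$. The GE-surplus is $\sigma_{\mathcal{G}}(T)=\sum_{K\in\mathcal{K}}\lfloor|T\cap K|/2\rfloor+\sum_{j}|T\cap A_j|-|T|$ for $T\subseteq V$. $T$ is $\sigma$-maximal if $\sigma(S)\le\sigma(T)$ for all $S\subseteq V$ and $\sigma(T')<\sigma(T)$ for all $T'\supsetneq T$. $\mathcal{G}$ is $D$-complete if each $G_j$, $j\in[q]$, is a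 vertex-disjoint union of cliques of odd size (so $A_j=C_j=\varnothing$), and $D$-acyclic if it is $D$-complete and $\mathcal{K}$ is a hyperforest, i.e. the bipartite incidence graph between $V$ and the edges of $\mathcal{K}$ (with $u\sim K$ iff $u\in K$) has no cycles. -}

module Defs where

open import Data.Bool using (Bool; true; false; _∧_; _∨_; not; if_then_else_)
open import Data.Nat as ℕ using (ℕ; zero; suc; _⊔_; _%_; _/_)
open import Data.Fin as Fin using (Fin; zero; suc; _<?_)
open import Data.Fin.Subset using (Subset; ∣_∣; _∩_; _⊂_; Nonempty; ⊥; ⁅_⁆)
open import Data.Vec as Vec using (Vec)
open import Data.List as List using (List; []; _∷_; _++_; [_]; length; map; foldr; concatMap; allFin; filterᵇ; lookup)
open import Data.Bool.ListAction using (any)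
open import Data.List.Relation.Unary.Linked using (Linked)
open import Data.List.Relation.Unary.Unique.Propositional using (Unique)
open import Data.Product using (_×_; _,_; proj₁; proj₂; Σ; ∃)
open import Data.Sum using (_⊎_; inj₁; inj₂)
open import Data.Integer as ℤ using (ℤ; +_; _-_; _<_; _≤_)
open import Data.Empty using (⊥)
open import Function using (_⇔_)
open import Relation.Nullary using (¬_; does)
open import Relation.Binary.PropositionalEquality using (_≡_; _≢_)

record Graph (n : ℕ) : Set where
  field
    adj     : Fin n → Fin n → Bool
    symm    : ∀ u v → adj u v ≡ adj v u
    irrefl  : ∀ v → adj v v ≡ false
open Graph public

_==_ : ∀ {n} → Fin n → Fin n → Bool
i == j = does (i Fin.≟ j)

edges : ∀ {n} → Graph n → List (Fin n × Fin n)
edges {n} G =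
  concatMap (λ i → map (λ j → (i , j))
              (filterᵇ (λ j → does (i <? j) ∧ adj G i j) (allFin n)))
            (allFin n)

sublists : ∀ {A : Set} → List A → List (List A)
sublists [] = [] ∷ []
sublists (x ∷ xs) = let r = sublists xs in r ++ map (x ∷_) r

covered : ∀ {n} → List (Fin n × Fin n) → Fin n → Bool
covered M v = any (λ e → (v == proj₁ e) ∨ (v == proj₂ e)) M

isMatching : ∀ {n} → List (Fin n × Fin n) → Bool
isMatching [] = true
isMatching (e ∷ M) = not (covered M (proj₁ e)) ∧ not (covered M (proj₂ e)) ∧ isMatching M

matchings : ∀ {n} → Graph n → List (List (Fin n × Fin n))
matchings G = filterᵇ isMatching (sublists (edges G))

ν : ∀ {n} → Graph n → ℕ
ν G = foldr _⊔_ 0 (map length (matchings G))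

GE-D : ∀ {n} → Graph n → Fin n → Bool
GE-D G v = any (λ M → does (length M ℕ.≟ ν G) ∧ not (covered M v)) (matchings G)

GE-A : ∀ {n} → Graph n → Fin n → Bool
GE-A {n} G v = not (GE-D G v) ∧ any (λ u → GE-D G u ∧ adj G u v) (allFin n)

GE-C : ∀ {n} → Graph n → Fin n → Bool
GE-C G v = not (GE-D G v) ∧ not (GE-A G v)

toSubset : ∀ {n} → (Fin n → Bool) → Subset n
toSubset = Vec.tabulate

reachIn : ∀ {n} → Graph n → (Fin n → Bool) → ℕ → Fin n → Fin n → Bool
reachIn G X zero    u v = X u ∧ (u == v)
reachIn {n} G X (suc k) u v =
  reachIn G X k u v ∨ any (λ w → reachIn G X k u w ∧ X v ∧ adj G w v) (allFin n)

component : ∀ {n} → Graph n → (Fin n → Bool) → Fin n → Subset n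
component {n} G X u = toSubset (reachIn G X n u)

-- Vertex sets of the nontrivial (≥ 2 vertices) components of G[X],
-- each listed once (represented by its least vertex).
nontrivialComponents : ∀ {n} → Graph n → (Fin n → Bool) → List (Subset n)
nontrivialComponents {n} G X =
  map (component G X)
    (filterᵇ (λ u → X u
                  ∧ not (any (λ w → does (w <? u) ∧ reachIn G X n u w) (allFin n))
                  ∧ does (2 ℕ.≤? ∣ component G X u ∣))
             (allFin n))

-- q-colourings: (G₀, G₁, …, G_q), G_j = colour j, G₀ = uncoloured edges.

record Colouring (n q : ℕ) : Set where
  field
    G      : Graph n
    colour : Fin (suc q) → Graph n
    union  : ∀ u v → (adj G u v ≡ true ⇔ ∃ λ j → adj (colour j) u v ≡ true)
open Colouring public

Gc : ∀ {n q} → Colouring n q → Fin q → Graph n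
Gc 𝒢 j = colour 𝒢 (suc j)

𝒦 : ∀ {n q} → Colouring n q → List (Subset n)
𝒦 {n} {q} 𝒢 with concatMap (λ j → nontrivialComponents (Gc 𝒢 j) (GE-D (Gc 𝒢 j))) (allFin q)
... | [] = fixed n
  where
  fixed : (m : ℕ) → List (Subset m)
  fixed zero    = []
  fixed (suc m) = [ ⁅ zero ⁆ ] -- the fixed vertex v = 0
... | Ks@(_ ∷ _) = Ks

𝒜 : ∀ {n q} → Colouring n q → List (Subset n)
𝒜 {q = q} 𝒢 = map (λ j → toSubset (GE-A (Gc 𝒢 j))) (allFin q)

sumℕ : List ℕ → ℕ
sumℕ = foldr ℕ._+_ 0

σ : ∀ {n q} → Colouring n q → Subset n → ℤ
σ 𝒢 T = (+ (sumℕ (map (λ K → ∣ T ∩ K ∣ / 2) (𝒦 𝒢)))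
        ℤ.+ + (sumℕ (map (λ A → ∣ T ∩ A ∣) (𝒜 𝒢))))
        - + ∣ T ∣

σ-maximal : ∀ {n q} → Colouring n q → Subset n → Set
σ-maximal 𝒢 T = (∀ S → σ 𝒢 S ≤ σ 𝒢 T) × (∀ T′ → T ⊂ T′ → σ 𝒢 T′ < σ 𝒢 T)

closedNbhd : ∀ {n} → Graph n → Fin n → Subset n
closedNbhd G v = toSubset (λ u → (u == v) ∨ adj G v u)

-- G is a vertex-disjoint union of cliques of odd size:
-- adjacency is transitive on distinct vertices (so components are cliques),
-- and every vertex's clique {v} ∪ N(v) has odd size.
OddCliqueUnion : ∀ {n} → Graph n → Set
OddCliqueUnion {n} G =
  (∀ u v w → adj G u v ≡ true → adj G v w ≡ true → u ≢ w → adj G u w ≡ true)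
  × (∀ v → ∣ closedNbhd G v ∣ % 2 ≡ 1)

D-complete : ∀ {n q} → Colouring n q → Set
D-complete 𝒢 = ∀ j → OddCliqueUnion (Gc 𝒢 j)

HasCycle : {X : Set} → (X → X → Set) → Set
HasCycle {X} R = Σ (List X) λ xs → Σ X λ x₀ → Σ X λ x₁ → Σ X λ x₂ →
  let cyc = x₀ ∷ x₁ ∷ x₂ ∷ xs in Unique cyc × Linked R (cyc ++ [ x₀ ])

Incidence : ∀ {n} (Ks : List (Subset n)) → (Fin n ⊎ Fin (length Ks)) → (Fin n ⊎ Fin (length Ks)) → Set
Incidence Ks (inj₁ u) (inj₂ e) = u Data.Fin.Subset.∈ lookup Ks e
Incidence Ks (inj₂ e) (inj₁ u) = u Data.Fin.Subset.∈ lookup Ks e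
Incidence Ks (inj₁ _) (inj₁ _) = Data.Empty.⊥
Incidence Ks (inj₂ _) (inj₂ _) = Data.Empty.⊥

Hyperforest : ∀ {n} → List (Subset n) → Set
Hyperforest Ks = ¬ HasCycle (Incidence Ks)

D-acyclic : ∀ {n q} → Colouring n q → Set
D-acyclic 𝒢 = D-complete 𝒢 × Hyperforest (𝒦 𝒢)

-- First, D-completeness empties every A_j. If adjacency is transitive on distinct vertices
-- and M is a maximum matching missing u, then for an edge uv with v matched to w by M,
-- replacing vw by uw gives a maximum matching missing v; so D_j is closed under taking
-- neighbours and no vertex outside D_j has a neighbour in it. Hence σ(S) = Σ_K ⌊|S ∩ K| / 2⌋ − |S|.
--
-- Second, in a hyperforest every nonempty S has a vertex x lying in at most one hyperedge K
-- with |S ∩ K| ≥ 2: otherwise every such vertex meets two such hyperedges and every such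
-- hyperedge contains two vertices of S, so a walk in the incidence graph that never turns
-- back must close a cycle. Removing x from S lowers Σ_K ⌊|S ∩ K| / 2⌋ by at most one, so by
-- induction on |S| this sum is smaller than |S| whenever S ≠ ∅.

module Submission where

open import Defs

module ListFacts where

  open import Data.Nat using (_≤_; z≤n; s≤s)
  open import Data.Nat.Properties using (≤-trans; ≤-reflexive; m≤n⇒m≤1+n)
  open import Data.List using (List; []; _∷_; _++_; [_]; length)
  open import Data.List.Membership.Propositional using (_∈_)
  open import Data.List.Membership.Propositional.Properties
    using (∈-∃++; ∈-++⁻; ∈-++⁺ˡ; ∈-++⁺ʳ; ∈-map⁺; ∈-map⁻)
  open import Data.List.Membership.DecPropositional as DecMembership using ()
  open import Data.List.Relation.Binary.Subset.Propositional using (_⊆_)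
  open import Data.List.Relation.Binary.Permutation.Propositional
    using (_↭_; ↭-refl; ↭-sym; ↭-trans; ↭-prep; ↭⇒↭ₛ)
  open import Data.List.Relation.Binary.Permutation.Propositional.Properties
    using (shift; ↭-length; ∈-resp-↭)
  import Data.List.Relation.Binary.Permutation.Setoid.Properties as Permₛ
  open import Data.List.Relation.Unary.All as All using (All; []; _∷_)
  import Data.List.Relation.Unary.All.Properties as All
  open import Data.List.Relation.Unary.AllPairs using (AllPairs; []; _∷_)
  open import Data.List.Relation.Unary.Any as Any using (here; there)
  open import Data.List.Relation.Unary.Linked using (Linked; [-]; _∷_)
  open import Data.List.Relation.Unary.Unique.Propositional using (Unique)
  open import Data.Product using (_×_; _,_; ∃-syntax)
  open import Data.Sum using (inj₁; inj₂)
  open import Relation.Binary using (Rel; Symmetric; DecidableEquality)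
  open import Relation.Binary.PropositionalEquality using (refl; sym; resp₂; ≢-sym; setoid)
  open import Relation.Nullary using (yes; no)

  module _ {A : Set} where

    AllPairs-resp-↭ : ∀ {ℓ} {R : Rel A ℓ} {xs ys} → Symmetric R →
                      AllPairs R xs → xs ↭ ys → AllPairs R ys
    AllPairs-resp-↭ R-sym rs σ = Permₛ.AllPairs-resp-↭ (setoid A) R-sym (resp₂ _) (↭⇒↭ₛ σ) rs

    sublists⇒⊆ : ∀ E {M : List A} → M ∈ sublists E → M ⊆ E
    sublists⇒⊆ [] (here refl) ()
    sublists⇒⊆ (x ∷ E) M∈ y∈M with ∈-++⁻ (sublists E) M∈
    ... | inj₁ M∈′ = there (sublists⇒⊆ E M∈′ y∈M)
    ... | inj₂ x∷M∈ with M′ , M′∈ , refl ← ∈-map⁻ (x ∷_) x∷M∈ with y∈M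
    ...   | here y≡x    = here y≡x
    ...   | there y∈M′ = there (sublists⇒⊆ E M′∈ y∈M′)

    sublists-length : ∀ E {M : List A} → M ∈ sublists E → length M ≤ length E
    sublists-length [] (here refl) = z≤n
    sublists-length (x ∷ E) M∈ with ∈-++⁻ (sublists E) M∈
    ... | inj₁ M∈′ = m≤n⇒m≤1+n (sublists-length E M∈′)
    ... | inj₂ x∷M∈ with M′ , M′∈ , refl ← ∈-map⁻ (x ∷_) x∷M∈ = s≤s (sublists-length E M′∈)

    module _ (_≟_ : DecidableEquality A) where

      open DecMembership _≟_ using (_∈?_)

      sublists-complete : ∀ E {L : List A} → Unique L → L ⊆ E → ∃[ M ] M ∈ sublists E × M ↭ L
      sublists-complete [] {[]} _ _ = [] , here refl , ↭-refl
      sublists-complete [] {_ ∷ _} _ L⊆[] with () ← L⊆[] (here refl)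
      sublists-complete (x ∷ E) {L} uL L⊆ with x ∈? L
      ... | no x∉L =
        let M , M∈ , M↭L = sublists-complete E uL (λ y∈L → Any.tail (λ { refl → x∉L y∈L }) (L⊆ y∈L))
        in M , ∈-++⁺ˡ M∈ , M↭L
      ... | yes x∈L with ys , zs , refl ← ∈-∃++ x∈L
                    with x∉ ∷ uL′ ← AllPairs-resp-↭ ≢-sym uL (shift x ys zs) =
        let L↭ = shift x ys zs
            M , M∈ , M↭L′ = sublists-complete E uL′ λ y∈L′ →
              Any.tail (λ { refl → All.lookup x∉ y∈L′ refl })
                       (L⊆ (∈-resp-↭ (↭-sym L↭) (there y∈L′)))
        in x ∷ M , ∈-++⁺ʳ (sublists E) (∈-map⁺ (x ∷_) M∈) , ↭-trans (↭-prep x M↭L′) (↭-sym L↭)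

      Unique-⊆⇒length≤ : ∀ {xs ys : List A} → Unique xs → xs ⊆ ys → length xs ≤ length ys
      Unique-⊆⇒length≤ {xs} {ys} u xs⊆ys =
        let M , M∈ , M↭xs = sublists-complete ys u xs⊆ys
        in ≤-trans (≤-reflexive (sym (↭-length M↭xs))) (sublists-length ys M∈)

    Unique-prefix : ∀ pre {b} {post : List A} → Unique (pre ++ b ∷ post) → Unique (pre ++ [ b ])
    Unique-prefix []        (_ ∷ _)   = [] ∷ []
    Unique-prefix (_ ∷ pre) (x∉ ∷ u) = prefix x∉ ∷ Unique-prefix pre u
      where
      prefix : ∀ {P : A → Set} {b post} → All P (pre ++ b ∷ post) → All P (pre ++ [ b ])
      prefix ps = All.++⁺ (All.++⁻ˡ pre ps) (All.head (All.++⁻ʳ pre ps) ∷ [])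

    Linked-close : ∀ {ℓ} {R : Rel A ℓ} pre {b post a} →
                   Linked R (pre ++ b ∷ post) → R b a → Linked R ((pre ++ [ b ]) ++ [ a ])
    Linked-close []            _        rba = rba ∷ [-]
    Linked-close (_ ∷ [])      (r ∷ _)  rba = r ∷ rba ∷ [-]
    Linked-close (_ ∷ y ∷ pre) (r ∷ rs) rba = r ∷ Linked-close (y ∷ pre) rs rba

module Cycles where

  open import Data.Nat using (zero; suc; _<_; _+_)
  open import Data.Nat.Properties using (<⇒≱; +-suc; +-identityʳ; n<1+n)
  open import Data.List using (List; []; _∷_; _++_; [_]; length)
  open import Data.List.Membership.Propositional using (_∈_)
  open import Data.List.Membership.Propositional.Properties using (∈-∃++)
  open import Data.List.Membership.DecPropositional as DecMembership using ()
  open import Data.List.Relation.Unary.All using ([]; _∷_)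
  open import Data.List.Relation.Unary.All.Properties using (¬Any⇒All¬)
  open import Data.List.Relation.Unary.AllPairs using ([]; _∷_)
  open import Data.List.Relation.Unary.Linked using (Linked; [-]; _∷_)
  open import Data.List.Relation.Unary.Unique.Propositional using (Unique)
  open import Data.Product using (_×_; _,_; ∃-syntax; ∃₂)
  open import Relation.Binary using (Symmetric; DecidableEquality)
  open import Relation.Binary.PropositionalEquality using (_≢_; refl; sym; subst)
  open import Relation.Nullary using (¬_; yes; no; contradiction)
  open ListFacts

  module _ {X : Set} (_≟_ : DecidableEquality X)
           {R : X → X → Set} (R-sym : Symmetric R) (R-irrefl : ∀ {x} → ¬ R x x)
           {E : List X} (E-complete : ∀ x → x ∈ E) where

    open DecMembership _≟_ using (_∈?_)

    MinDegree≥2 : (X → Set) → Set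
    MinDegree≥2 P = ∀ {a} → P a → ∃₂ λ b b′ → b ≢ b′ × (P b × R a b) × (P b′ × R a b′)

    -- Walk from a P-vertex without ever returning to the vertex just left; the walk is kept
    -- as a repetition-free list, newest vertex first, which cannot outgrow E.
    min-degree-two⇒cycle : ∀ {P} → MinDegree≥2 P → ∀ {a} → P a → HasCycle R
    min-degree-two⇒cycle {P} deg pa = walk (length E) [] ([] ∷ []) [-] pa (n<1+n _)
      where
      previous : X → List X → X
      previous a []      = a
      previous _ (c ∷ _) = c

      step-avoiding : ∀ {a} → P a → ∀ c → ∃[ b ] P b × R a b × b ≢ c
      step-avoiding pa c with b , b′ , b≢b′ , (pb , rab) , (pb′ , rab′) ← deg pa with b ≟ c
      ... | no b≢c   = b , pb , rab , b≢c
      ... | yes refl = b′ , pb′ , rab′ , λ b′≡b → b≢b′ (sym b′≡b)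

      walk : ∀ fuel {a} path → Unique (a ∷ path) → Linked R (a ∷ path) → P a →
             length E < length (a ∷ path) + fuel → HasCycle R
      walk zero path u _ _ E< =
        contradiction (Unique-⊆⇒length≤ _≟_ u λ {x} _ → E-complete x)
                      (<⇒≱ (subst (length E <_) (+-identityʳ _) E<))
      walk (suc fuel) {a} path u l pa E<
        with b , pb , rab , b≢prev ← step-avoiding pa (previous a path)
        with b ∈? (a ∷ path)
      ... | no b∉ = walk fuel (a ∷ path) (¬Any⇒All¬ _ b∉ ∷ u) (R-sym rab ∷ l) pb
                         (subst (length E <_) (+-suc _ fuel) E<)
      ... | yes b∈ with ∈-∃++ b∈
      ...   | []             , _ , refl = contradiction rab R-irrefl
      ...   | _ ∷ []         , _ , refl = contradiction refl b≢prev
      ...   | _ ∷ y ∷ []     , _ , refl =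
        [] , a , y , b , Unique-prefix (a ∷ y ∷ []) u , Linked-close (a ∷ y ∷ []) l (R-sym rab)
      ...   | _ ∷ y ∷ z ∷ zs , _ , refl =
        zs ++ [ b ] , a , y , z ,
        Unique-prefix (a ∷ y ∷ z ∷ zs) u , Linked-close (a ∷ y ∷ z ∷ zs) l (R-sym rab)

module SubsetFacts where

  open import Data.Bool using (false)
  open import Data.Nat using (ℕ; zero; suc; _≤_; _<_; z≤n; s≤s)
  open import Data.Nat.Properties using (≤-reflexive; ≤-trans; n≤1+n; >⇒≢; ≤-pred)
  open import Data.Fin using (Fin; zero; suc)
  open import Data.Fin.Subset
    using (Subset; inside; outside; _∈_; _∉_; _∩_; _─_; _-_; ⊥; ∣_∣; _⊆_; Nonempty)
  open import Data.Fin.Subset.Properties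
    using (p─⊥≡p; p─q⊆p; p⊆q⇒∣p∣≤∣q∣; x∈p∩q⁺; x∈p∩q⁻; x∈p∧x≢y⇒x∈p-y; x∉⁅y⁆⇒x≢y;
           nonempty?; Empty-unique; ∣⊥∣≡0)
  open import Data.Product using (_×_; _,_; ∃₂)
  open import Data.Vec using (_∷_; there)
  open import Function using (_∘_)
  open import Relation.Binary.PropositionalEquality using (_≡_; _≢_; refl; sym; trans; cong)
  open import Relation.Nullary using (yes; no; contradiction)

  private variable
    n : ℕ

  x∈p─q⇒x∉q : ∀ {x : Fin n} {p q} → x ∈ p ─ q → x ∉ q
  x∈p─q⇒x∉q {p = _ ∷ _} {inside  ∷ _} (there x∈p─q) (there x∈q) = x∈p─q⇒x∉q x∈p─q x∈q
  x∈p─q⇒x∉q {p = _ ∷ _} {outside ∷ _} (there x∈p─q) (there x∈q) = x∈p─q⇒x∉q x∈p─q x∈q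

  x∈p-y⇒x≢y : ∀ {x y : Fin n} {p} → x ∈ p - y → x ≢ y
  x∈p-y⇒x≢y = x∉⁅y⁆⇒x≢y ∘ x∈p─q⇒x∉q

  ∣p∣≤1+∣p-x∣ : ∀ (p : Subset n) x → ∣ p ∣ ≤ suc ∣ p - x ∣
  ∣p∣≤1+∣p-x∣ (inside  ∷ p) zero    = ≤-reflexive (cong (suc ∘ ∣_∣) (sym (p─⊥≡p p)))
  ∣p∣≤1+∣p-x∣ (outside ∷ p) zero    =
    ≤-trans (n≤1+n _) (≤-reflexive (cong (suc ∘ ∣_∣) (sym (p─⊥≡p p))))
  ∣p∣≤1+∣p-x∣ (inside  ∷ p) (suc x) = s≤s (∣p∣≤1+∣p-x∣ p x)
  ∣p∣≤1+∣p-x∣ (outside ∷ p) (suc x) = ∣p∣≤1+∣p-x∣ p x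

  ∣p∩q∣≤1+∣[p-x]∩q∣ : ∀ (p q : Subset n) x → ∣ p ∩ q ∣ ≤ suc ∣ (p - x) ∩ q ∣
  ∣p∩q∣≤1+∣[p-x]∩q∣ p q x = ≤-trans (∣p∣≤1+∣p-x∣ (p ∩ q) x) (s≤s (p⊆q⇒∣p∣≤∣q∣ [p∩q]-x⊆[p-x]∩q))
    where
    [p∩q]-x⊆[p-x]∩q : (p ∩ q) - x ⊆ (p - x) ∩ q
    [p∩q]-x⊆[p-x]∩q y∈ with y∈p , y∈q ← x∈p∩q⁻ p q (p─q⊆p _ _ y∈) =
      x∈p∩q⁺ (x∈p∧x≢y⇒x∈p-y y∈p (x∈p-y⇒x≢y y∈) , y∈q)

  x∉q⇒∣p∩q∣≤∣[p-x]∩q∣ : ∀ (p q : Subset n) {x} → x ∉ q → ∣ p ∩ q ∣ ≤ ∣ (p - x) ∩ q ∣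
  x∉q⇒∣p∩q∣≤∣[p-x]∩q∣ p q {x} x∉q = p⊆q⇒∣p∣≤∣q∣ {q = (p - x) ∩ q} λ y∈ →
    let y∈p , y∈q = x∈p∩q⁻ p q y∈
    in x∈p∩q⁺ (x∈p∧x≢y⇒x∈p-y y∈p (λ { refl → x∉q y∈q }) , y∈q)

  ∣p∣>0⇒Nonempty : ∀ (p : Subset n) → 0 < ∣ p ∣ → Nonempty p
  ∣p∣>0⇒Nonempty {n} p 0<∣p∣ with nonempty? p
  ... | yes ne    = ne
  ... | no  empty = contradiction (trans (cong ∣_∣ (Empty-unique empty)) (∣⊥∣≡0 n)) (>⇒≢ 0<∣p∣)

  ∣p∣≥2⇒two-members : ∀ (p : Subset n) → 2 ≤ ∣ p ∣ → ∃₂ λ x y → x ≢ y × x ∈ p × y ∈ p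
  ∣p∣≥2⇒two-members p 2≤∣p∣
    with x , x∈p ← ∣p∣>0⇒Nonempty p (≤-trans (s≤s z≤n) 2≤∣p∣)
    with y , y∈p-x ← ∣p∣>0⇒Nonempty (p - x) (≤-pred (≤-trans 2≤∣p∣ (∣p∣≤1+∣p-x∣ p x))) =
    x , y , (λ x≡y → x∈p-y⇒x≢y y∈p-x (sym x≡y)) , x∈p , p─q⊆p p _ y∈p-x

  toSubset-false : ∀ {f : Fin n → _} → (∀ v → f v ≡ false) → toSubset f ≡ ⊥
  toSubset-false {zero}          _       = refl
  toSubset-false {suc n} {f} f≡false rewrite f≡false zero =
    cong (outside ∷_) (toSubset-false (f≡false ∘ suc))

module Hyperforests where

  open import Data.Nat using (ℕ; zero; suc; _≤_; _<_; _+_; _/_; z≤n; s≤s; _≤?_)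
  open import Data.Nat.Properties
    using (≤-reflexive; n≤1+n; ≤-trans; ≤-pred; +-mono-≤; +-monoʳ-≤; +-assoc; +-comm; ≰⇒>;
           ≤-<-trans; module ≤-Reasoning)
  open import Data.Nat.DivMod using (/-monoˡ-≤; m<n⇒m/n≡0; m/n≡1+[m∸n]/n)
  open import Data.Nat.Induction using (<-wellFounded)
  open import Data.Nat.Tactic.RingSolver using (solve-∀)
  open import Induction.WellFounded using (Acc; acc)
  open import Data.Fin using (Fin; zero; suc)
  open import Data.Fin.Properties using (any?; suc-injective) renaming (_≟_ to _≟ᶠ_)
  open import Data.Fin.Subset using (Subset; _∈_; _∩_; _-_; ⁅_⁆; ∣_∣; Nonempty)
  open import Data.Fin.Subset.Properties
    using (_∈?_; nonempty?; x∈p∩q⁻; x∈p∧x≢y⇒x∈p-y; x∈p⇒∣p-x∣<∣p∣; p⊆q⇒∣p∣≤∣q∣; ∣⁅x⁆∣≡1; ∣p∩q∣≤∣p∣;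
           x∈⁅x⁆)
  open import Data.List using (List; []; _∷_; _++_; length; map; filter; lookup; allFin)
  open import Data.List.Properties using (filter-accept; filter-reject)
  open import Data.List.Membership.Propositional using () renaming (_∈_ to _∈ₗ_)
  open import Data.List.Membership.Propositional.Properties using (∈-++⁺ˡ; ∈-++⁺ʳ; ∈-map⁺; ∈-allFin)
  open import Data.Product using (_×_; _,_; ∃-syntax; ∃₂)
  open import Data.Sum using (_⊎_; inj₁; inj₂)
  open import Data.Sum.Properties using (inj₂-injective) renaming (≡-dec to ⊎-≡-dec)
  open import Function using (_∘_)
  open import Relation.Binary.PropositionalEquality using (_≡_; _≢_; refl; sym)
  open import Relation.Nullary using (¬_; yes; no; contradiction)
  open import Relation.Nullary.Decidable using (_×-dec_)
  open import Relation.Unary using (Decidable)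
  open Cycles using (min-degree-two⇒cycle)
  open SubsetFacts

  module _ {A : Set} {P : A → Set} (P? : Decidable P) where

    filter-nonempty⇒witness : ∀ xs → 1 ≤ length (filter P? xs) → ∃[ i ] P (lookup xs i)
    filter-nonempty⇒witness (y ∷ ys) h with P? y
    ... | yes py = zero , py
    ... | no _   = let i , pi = filter-nonempty⇒witness ys h in suc i , pi

    filter-≥2⇒two-witnesses : ∀ xs → 2 ≤ length (filter P? xs) →
                               ∃₂ λ i j → i ≢ j × P (lookup xs i) × P (lookup xs j)
    filter-≥2⇒two-witnesses (y ∷ ys) h with P? y
    ... | yes py = let j , pj = filter-nonempty⇒witness ys (≤-pred h)
                   in zero , suc j , (λ ()) , py , pj
    ... | no _   = let i , j , i≢j , pi , pj = filter-≥2⇒two-witnesses ys h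
                   in suc i , suc j , i≢j ∘ suc-injective , pi , pj

  m≤1+n⇒m/2≤1+n/2 : ∀ {m n} → m ≤ suc n → m / 2 ≤ suc (n / 2)
  m≤1+n⇒m/2≤1+n/2 {n = n} m≤1+n =
    ≤-trans (/-monoˡ-≤ 2 (≤-trans m≤1+n (n≤1+n _)))
            (≤-reflexive (m/n≡1+[m∸n]/n {2 + n} (s≤s (s≤s z≤n))))

  sumℕ-zero : ∀ {A : Set} (f : A → ℕ) xs → (∀ x → f x ≡ 0) → sumℕ (map f xs) ≡ 0
  sumℕ-zero f []       _ = refl
  sumℕ-zero f (x ∷ xs) z rewrite z x = sumℕ-zero f xs z

  module _ {n : ℕ} where

    pairs : List (Subset n) → Subset n → ℕ
    pairs Ks S = sumℕ (map (λ K → ∣ S ∩ K ∣ / 2) Ks)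

    Heavy : Subset n → Fin n → Subset n → Set
    Heavy S x K = x ∈ K × 2 ≤ ∣ S ∩ K ∣

    heavy? : ∀ (S : Subset n) x → Decidable (Heavy S x)
    heavy? S x K = (x ∈? K) ×-dec (2 ≤? ∣ S ∩ K ∣)

    heavyDegree : List (Subset n) → Subset n → Fin n → ℕ
    heavyDegree Ks S x = length (filter (heavy? S x) Ks)

    pairs-small : ∀ Ks (S : Subset n) → ∣ S ∣ ≤ 1 → pairs Ks S ≡ 0
    pairs-small Ks S ∣S∣≤1 = sumℕ-zero _ Ks λ K → m<n⇒m/n≡0 (s≤s (≤-trans (∣p∩q∣≤∣p∣ S K) ∣S∣≤1))

    half-remove : ∀ (S : Subset n) x K → ∣ S ∩ K ∣ / 2 ≤ suc (∣ (S - x) ∩ K ∣ / 2)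
    half-remove S x K = m≤1+n⇒m/2≤1+n/2 (∣p∩q∣≤1+∣[p-x]∩q∣ S K x)

    half-remove-light : ∀ (S : Subset n) x K → ¬ Heavy S x K → ∣ S ∩ K ∣ / 2 ≤ ∣ (S - x) ∩ K ∣ / 2
    half-remove-light S x K light with x ∈? K
    ... | no x∉K  = /-monoˡ-≤ 2 (x∉q⇒∣p∩q∣≤∣[p-x]∩q∣ S K x∉K)
    ... | yes x∈K with 2 ≤? ∣ S ∩ K ∣
    ...   | yes 2≤ = contradiction (x∈K , 2≤) light
    ...   | no  2≰ = ≤-trans (≤-reflexive (m<n⇒m/n≡0 (≰⇒> 2≰))) z≤n

    pairs-remove : ∀ Ks (S : Subset n) x → pairs Ks S ≤ pairs Ks (S - x) + heavyDegree Ks S x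
    pairs-remove []       S x = z≤n
    pairs-remove (K ∷ Ks) S x with heavy? S x K
    ... | yes heavy rewrite filter-accept (heavy? S x) {xs = Ks} heavy =
      ≤-trans (+-mono-≤ (half-remove S x K) (pairs-remove Ks S x))
              (≤-reflexive (regroup (∣ (S - x) ∩ K ∣ / 2) (pairs Ks (S - x)) (heavyDegree Ks S x)))
      where
      regroup : ∀ a b d → suc a + (b + d) ≡ a + b + suc d
      regroup = solve-∀
    ... | no light rewrite filter-reject (heavy? S x) {xs = Ks} light =
      ≤-trans (+-mono-≤ (half-remove-light S x K light) (pairs-remove Ks S x))
              (≤-reflexive (sym (+-assoc (∣ (S - x) ∩ K ∣ / 2) _ _)))

    module _ (Ks : List (Subset n)) (forest : Hyperforest Ks) where

      hyperforest-leaf : ∀ S → Nonempty S → ∃[ x ] x ∈ S × heavyDegree Ks S x ≤ 1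
      hyperforest-leaf S (x₀ , x₀∈S) with any? (λ x → (x ∈? S) ×-dec (heavyDegree Ks S x ≤? 1))
      ... | yes leaf = leaf
      ... | no ¬leaf =
        contradiction (min-degree-two⇒cycle (⊎-≡-dec _≟ᶠ_ _≟ᶠ_) incidence-sym incidence-irrefl
                                            complete degree≥2 {inj₁ x₀} x₀∈S)
                      forest
        where
        V = Fin n ⊎ Fin (length Ks)

        incidence-sym : ∀ {a b : V} → Incidence Ks a b → Incidence Ks b a
        incidence-sym {inj₁ _} {inj₂ _} u∈K = u∈K
        incidence-sym {inj₂ _} {inj₁ _} u∈K = u∈K

        incidence-irrefl : ∀ {a : V} → ¬ Incidence Ks a a
        incidence-irrefl {inj₁ _} ()
        incidence-irrefl {inj₂ _} ()

        complete : ∀ a → a ∈ₗ map inj₁ (allFin n) ++ map inj₂ (allFin (length Ks))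
        complete (inj₁ x) = ∈-++⁺ˡ (∈-map⁺ inj₁ (∈-allFin x))
        complete (inj₂ i) = ∈-++⁺ʳ (map inj₁ (allFin n)) (∈-map⁺ inj₂ (∈-allFin i))

        Active : V → Set
        Active (inj₁ x) = x ∈ S
        Active (inj₂ i) = 2 ≤ ∣ S ∩ lookup Ks i ∣

        degree≥2 : ∀ {a} → Active a →
                   ∃₂ λ b b′ → b ≢ b′ × (Active b × Incidence Ks a b)
                                      × (Active b′ × Incidence Ks a b′)
        degree≥2 {inj₁ x} x∈S
          with i , j , i≢j , (x∈Kᵢ , 2≤ᵢ) , (x∈Kⱼ , 2≤ⱼ) ←
                 filter-≥2⇒two-witnesses (heavy? S x) Ks (≰⇒> λ d≤1 → ¬leaf (x , x∈S , d≤1))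
          = inj₂ i , inj₂ j , i≢j ∘ inj₂-injective , (2≤ᵢ , x∈Kᵢ) , (2≤ⱼ , x∈Kⱼ)
        degree≥2 {inj₂ i} 2≤
          with y , y′ , y≢y′ , y∈ , y′∈ ← ∣p∣≥2⇒two-members (S ∩ lookup Ks i) 2≤
          with y∈S , y∈K ← x∈p∩q⁻ S _ y∈ | y′∈S , y′∈K ← x∈p∩q⁻ S _ y′∈
          = inj₁ y , inj₁ y′ , (λ { refl → y≢y′ refl }) , (y∈S , y∈K) , (y′∈S , y′∈K)

      pairs<∣S∣ : ∀ S → Nonempty S → pairs Ks S < ∣ S ∣
      pairs<∣S∣ S ne = go S ne (<-wellFounded ∣ S ∣)
        where
        go : ∀ S → Nonempty S → Acc _<_ ∣ S ∣ → pairs Ks S < ∣ S ∣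
        go S ne (acc smaller) with x , x∈S , d≤1 ← hyperforest-leaf S ne | nonempty? (S - x)
        ... | yes ne′ = begin-strict
          pairs Ks S                             ≤⟨ pairs-remove Ks S x ⟩
          pairs Ks (S - x) + heavyDegree Ks S x  ≤⟨ +-monoʳ-≤ (pairs Ks (S - x)) d≤1 ⟩
          pairs Ks (S - x) + 1                   ≡⟨ +-comm (pairs Ks (S - x)) 1 ⟩
          suc (pairs Ks (S - x))                 ≤⟨ go (S - x) ne′ (smaller (x∈p⇒∣p-x∣<∣p∣ x∈S)) ⟩
          ∣ S - x ∣                              <⟨ x∈p⇒∣p-x∣<∣p∣ x∈S ⟩
          ∣ S ∣                                  ∎
          where open ≤-Reasoning
        ... | no S-x-empty = begin-strict
          pairs Ks S  ≡⟨ pairs-small Ks S (≤-trans (p⊆q⇒∣p∣≤∣q∣ S⊆⁅x⁆) (≤-reflexive (∣⁅x⁆∣≡1 x))) ⟩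
          0           <⟨ ≤-<-trans z≤n (x∈p⇒∣p-x∣<∣p∣ x∈S) ⟩
          ∣ S ∣       ∎
          where
          open ≤-Reasoning
          S⊆⁅x⁆ : ∀ {y} → y ∈ S → y ∈ ⁅ x ⁆
          S⊆⁅x⁆ {y} y∈S with y ≟ᶠ x
          ... | yes refl = x∈⁅x⁆ x
          ... | no y≢x   = contradiction (y , x∈p∧x≢y⇒x∈p-y y∈S y≢x) S-x-empty

module Matchings where

  open import Data.Bool using (Bool; true; false; T; T?; not; _∧_)
  open import Data.Bool.Properties using (T-∧; T-∨; T-≡; T-not-≡)
  open import Data.Unit using (tt)
  open import Data.Nat as ℕ using (ℕ)
  open import Data.Fin as Fin using (Fin; _<?_)
  open import Data.Fin.Properties using (<-cmp) renaming (_≟_ to _≟ᶠ_)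
  open import Data.List using (List; []; _∷_; _++_; length; map; filterᵇ; allFin)
  open import Data.List.Membership.Propositional using (_∈_; lose; find)
  open import Data.List.Membership.Propositional.Properties
    using (∈-∃++; ∈-filter⁺; ∈-filter⁻; ∈-map⁺; ∈-map⁻; ∈-concatMap⁺; ∈-concatMap⁻; ∈-allFin)
  open import Data.List.Relation.Binary.Subset.Propositional using (_⊆_)
  open import Data.List.Relation.Binary.Subset.Propositional.Properties using (Any-resp-⊆)
  open import Data.List.Relation.Binary.Permutation.Propositional using (_↭_; ↭-sym)
  open import Data.List.Relation.Binary.Permutation.Propositional.Properties
    using (shift; ↭-length; ∈-resp-↭; Any-resp-↭)
  open import Data.List.Relation.Unary.All as All using (All; []; _∷_)
  open import Data.List.Relation.Unary.All.Properties using (All¬⇒¬Any)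
  open import Data.List.Relation.Unary.AllPairs as AllPairs using (AllPairs; []; _∷_)
  open import Data.List.Relation.Unary.Any as Any using (Any; here; there)
  open import Data.List.Relation.Unary.Any.Properties using (any⇔)
  open import Data.Product using (_×_; _,_; proj₁; proj₂; ∃; ∃-syntax)
  open import Data.Product.Properties using () renaming (≡-dec to ×-≡-dec)
  open import Data.Sum using (_⊎_; inj₁; inj₂) renaming (map to ⊎-map; swap to ⊎-swap)
  open import Function using (_∘_; _⇔_; mk⇔; Equivalence)
  open import Relation.Binary using (Rel; Symmetric; tri<; tri≈; tri>)
  open import Relation.Binary.PropositionalEquality using (_≡_; _≢_; refl; sym; trans)
  open import Relation.Nullary using (¬_; Dec; yes; no; does; contradiction)
  open import Relation.Nullary.Decidable using (_⊎-dec_)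
  open ListFacts using (AllPairs-resp-↭; sublists⇒⊆; sublists-complete)

  open Equivalence using (to; from)

  private variable
    n : ℕ

  T-not⇔¬T : ∀ {b} → T (not b) ⇔ (¬ T b)
  T-not⇔¬T {false} = mk⇔ (λ _ ()) (λ _ → tt)
  T-not⇔¬T {true}  = mk⇔ (λ ()) (λ ¬tt → ¬tt tt)

  T-does⇔ : ∀ {P : Set} (P? : Dec P) → T (does P?) ⇔ P
  T-does⇔ (yes p)  = mk⇔ (λ _ → p) (λ _ → tt)
  T-does⇔ (no ¬p) = mk⇔ (λ ()) ¬p

  T-==⇔≡ : ∀ {i j : Fin n} → T (i == j) ⇔ i ≡ j
  T-==⇔≡ {i = i} {j} = T-does⇔ (i ≟ᶠ j)

  Endpoint : Fin n → Fin n × Fin n → Set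
  Endpoint v e = v ≡ proj₁ e ⊎ v ≡ proj₂ e

  T-covered⇔Any : ∀ {M : List (Fin n × Fin n)} {v} → T (covered M v) ⇔ Any (Endpoint v) M
  T-covered⇔Any {M = M} =
    mk⇔ (Any.map (⊎-map (to T-==⇔≡) (to T-==⇔≡) ∘ to T-∨) ∘ from (any⇔ {xs = M}))
        (to any⇔ ∘ Any.map (from T-∨ ∘ ⊎-map (from T-==⇔≡) (from T-==⇔≡)))

  Apart : Rel (Fin n × Fin n) _
  Apart e f = ∀ {v} → Endpoint v e → ¬ Endpoint v f

  Apart-sym : Symmetric (Apart {n})
  Apart-sym ap v∈f v∈e = ap v∈e v∈f

  Apart⇒≢ : ∀ {e f : Fin n × Fin n} → Apart e f → e ≢ f
  Apart⇒≢ ap refl = ap (inj₁ refl) (inj₁ refl)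

  All-Apart⇒avoids : ∀ {e} {M : List (Fin n × Fin n)} {v} →
                     All (Apart e) M → Endpoint v e → ¬ Any (Endpoint v) M
  All-Apart⇒avoids aps v∈e = All¬⇒¬Any (All.map (λ ap → ap v∈e) aps)

  avoids⇒All-Apart : ∀ {e} {M : List (Fin n × Fin n)} →
                     (∀ {v} → Endpoint v e → ¬ Any (Endpoint v) M) → All (Apart e) M
  avoids⇒All-Apart avoids = All.tabulate λ f∈M v∈e v∈f → avoids v∈e (lose f∈M v∈f)

  isMatching⇒AllPairs : ∀ (M : List (Fin n × Fin n)) → T (isMatching M) → AllPairs Apart M
  isMatching⇒AllPairs []      _ = []
  isMatching⇒AllPairs (e ∷ M) t
    with t₁ , t₂₃ ← to T-∧ t
    with t₂ , t₃ ← to T-∧ t₂₃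
    = avoids⇒All-Apart (λ { (inj₁ refl) → avoids t₁ ; (inj₂ refl) → avoids t₂ })
      ∷ isMatching⇒AllPairs M t₃
    where
    avoids : ∀ {v} → T (not (covered M v)) → ¬ Any (Endpoint v) M
    avoids t = to T-not⇔¬T t ∘ from T-covered⇔Any

  AllPairs⇒isMatching : ∀ {M : List (Fin n × Fin n)} → AllPairs Apart M → T (isMatching M)
  AllPairs⇒isMatching []         = tt
  AllPairs⇒isMatching {M = e ∷ M} (ap ∷ aps) =
    from T-∧ (uncovered (inj₁ refl) , from T-∧ (uncovered (inj₂ refl) , AllPairs⇒isMatching aps))
    where
    uncovered : ∀ {v} → Endpoint v e → T (not (covered M v))
    uncovered v∈e = from T-not⇔¬T (All-Apart⇒avoids ap v∈e ∘ to T-covered⇔Any)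

  module _ (G : Graph n) where

    private
      edge? : Fin n → Fin n → Bool
      edge? i j = does (i <? j) ∧ adj G i j

      edgesFrom : Fin n → List (Fin n × Fin n)
      edgesFrom i = map (i ,_) (filterᵇ (edge? i) (allFin n))

    ∈-edges⇒adj : ∀ {e} → e ∈ edges G → adj G (proj₁ e) (proj₂ e) ≡ true
    ∈-edges⇒adj e∈ with i , e∈row ← Any.satisfied (∈-concatMap⁻ edgesFrom {xs = allFin n} e∈)
                   with j , j∈ , refl ← ∈-map⁻ (i ,_) e∈row =
      to T-≡ (proj₂ (to T-∧ (proj₂ (∈-filter⁻ (T? ∘ edge? i) {xs = allFin n} j∈))))

    adj⇒∈-edges : ∀ {i j} → i Fin.< j → adj G i j ≡ true → (i , j) ∈ edges G
    adj⇒∈-edges {i} {j} i<j ij =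
      ∈-concatMap⁺ edgesFrom (Any.map (λ { refl → j∈edgesFrom }) (∈-allFin i))
      where
      j∈edgesFrom : (i , j) ∈ edgesFrom i
      j∈edgesFrom = ∈-map⁺ (i ,_) (∈-filter⁺ (T? ∘ edge? i) (∈-allFin j)
                                     (from T-∧ (from (T-does⇔ (i <? j)) i<j , from T-≡ ij)))

    edge-between : ∀ {i j} → i ≢ j → adj G i j ≡ true →
                   ∃[ e ] e ∈ edges G × (∀ {v} → Endpoint v e → v ≡ i ⊎ v ≡ j)
    edge-between {i} {j} i≢j ij with <-cmp i j
    ... | tri< i<j _ _ = (i , j) , adj⇒∈-edges i<j ij , λ v∈e → v∈e
    ... | tri≈ _ i≡j _ = contradiction i≡j i≢j
    ... | tri> _ _ j<i = (j , i) , adj⇒∈-edges j<i (trans (symm G j i) ij) , ⊎-swap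

    MaximumMatchingMissing : Fin n → List (Fin n × Fin n) → Set
    MaximumMatchingMissing v M = M ∈ matchings G × length M ≡ ν G × ¬ Any (Endpoint v) M

    T-GE-D⇔ : ∀ {v} → T (GE-D G v) ⇔ ∃ (MaximumMatchingMissing v)
    T-GE-D⇔ {v} = mk⇔ witness (to any⇔ ∘ evidence)
      where
      evidence : ∃ (MaximumMatchingMissing v) →
                 Any (λ M → T (does (length M ℕ.≟ ν G) ∧ not (covered M v))) (matchings G)
      evidence (M , M∈ , |M|≡ν , missing) =
        lose M∈ (from T-∧ ( from (T-does⇔ (length M ℕ.≟ ν G)) |M|≡ν
                          , from T-not⇔¬T (missing ∘ to T-covered⇔Any)))
      witness : T (GE-D G v) → ∃ (MaximumMatchingMissing v)
      witness t with M , M∈ , tM ← find (from any⇔ t) with |M|≡ν , uncovered ← to T-∧ tM =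
        M , M∈ , to (T-does⇔ (length M ℕ.≟ ν G)) |M|≡ν , to T-not⇔¬T uncovered ∘ from T-covered⇔Any

    ∈-matchings⁻ : ∀ {M} → M ∈ matchings G → M ∈ sublists (edges G) × AllPairs Apart M
    ∈-matchings⁻ {M} M∈
      with M∈sublists , isMatching-M ← ∈-filter⁻ (T? ∘ isMatching) {xs = sublists (edges G)} M∈ =
      M∈sublists , isMatching⇒AllPairs M isMatching-M

    matchings-complete : ∀ {L} → AllPairs Apart L → L ⊆ edges G → ∃[ M ] M ∈ matchings G × M ↭ L
    matchings-complete apL L⊆
      with M , M∈ , M↭L ←
             sublists-complete (×-≡-dec _≟ᶠ_ _≟ᶠ_) (edges G) (AllPairs.map Apart⇒≢ apL) L⊆ =
      M , ∈-filter⁺ (T? ∘ isMatching) M∈ (AllPairs⇒isMatching (AllPairs-resp-↭ Apart-sym apL (↭-sym M↭L)))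
        , M↭L

    matching-swap : ∀ {M e R e′} → M ∈ matchings G → M ↭ e ∷ R → e′ ∈ edges G → All (Apart e′) R →
                    ∃[ M′ ] M′ ∈ matchings G × length M′ ≡ length M × M′ ↭ e′ ∷ R
    matching-swap {M} {e} {R} {e′} M∈ M↭ e′∈ e′-apart
      with M∈sublists , M-matching ← ∈-matchings⁻ M∈ =
      let M′ , M′∈ , M′↭ = matchings-complete (e′-apart ∷ R-matching) e′∷R⊆edges
      in M′ , M′∈ , trans (↭-length M′↭) (sym (↭-length M↭)) , M′↭
      where
      R-matching : AllPairs Apart R
      R-matching = AllPairs.tail (AllPairs-resp-↭ Apart-sym M-matching M↭)

      e′∷R⊆edges : e′ ∷ R ⊆ edges G
      e′∷R⊆edges (here refl)  = e′∈
      e′∷R⊆edges (there y∈R) = sublists⇒⊆ (edges G) M∈sublists (∈-resp-↭ (↭-sym M↭) (there y∈R))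

    adj⇒≢ : ∀ {u v} → adj G u v ≡ true → u ≢ v
    adj⇒≢ {u} uv refl with () ← trans (sym (irrefl G u)) uv

    partner : ∀ {e v} → e ∈ edges G → Endpoint v e → ∃[ w ] Endpoint w e × adj G v w ≡ true
    partner e∈ (inj₁ refl) = _ , inj₂ refl , ∈-edges⇒adj e∈
    partner e∈ (inj₂ refl) = _ , inj₁ refl , trans (symm G _ _) (∈-edges⇒adj e∈)

    uncovered≢endpoint : ∀ {u w : Fin n} {e M} → ¬ Any (Endpoint u) M → e ∈ M → Endpoint w e → u ≢ w
    uncovered≢endpoint u∉M e∈M w∈e refl = u∉M (lose e∈M w∈e)

    module _ (transitive : ∀ u v w → adj G u v ≡ true → adj G v w ≡ true → u ≢ w →
                           adj G u w ≡ true) where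

      missing-spreads : ∀ {u v} → ∃ (MaximumMatchingMissing u) → adj G u v ≡ true →
                        ∃ (MaximumMatchingMissing v)
      missing-spreads {u} {v} (M , M∈ , |M|≡ν , u∉M) uv
        with Any.any? (λ e → (v ≟ᶠ proj₁ e) ⊎-dec (v ≟ᶠ proj₂ e)) M
      ... | no v∉M = M , M∈ , |M|≡ν , v∉M
      ... | yes v∈M
        with e , e∈M , v∈e ← find v∈M
        with M∈sublists , M-matching ← ∈-matchings⁻ M∈
        with w , w∈e , vw ← partner (sublists⇒⊆ (edges G) M∈sublists e∈M) v∈e
        with u≢w ← uncovered≢endpoint u∉M e∈M w∈e
        with e′ , e′∈ , e′-ends ← edge-between u≢w (transitive u v w uv vw u≢w)
        with ys , zs , refl ← ∈-∃++ e∈M =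
        let M′ , M′∈ , |M′|≡|M| , M′↭ = matching-swap M∈ M↭ e′∈ (avoids⇒All-Apart R-avoids-e′)
        in M′ , M′∈ , trans |M′|≡|M| |M|≡ν , v∉e′∷R ∘ Any-resp-↭ M′↭
        where
        M↭ = shift e ys zs

        e-apart : All (Apart e) (ys ++ zs)
        e-apart = AllPairs.head (AllPairs-resp-↭ Apart-sym M-matching M↭)

        R-avoids-e′ : ∀ {x} → Endpoint x e′ → ¬ Any (Endpoint x) (ys ++ zs)
        R-avoids-e′ x∈e′ with e′-ends x∈e′
        ... | inj₁ refl = u∉M ∘ Any-resp-⊆ (λ y∈R → ∈-resp-↭ (↭-sym M↭) (there y∈R))
        ... | inj₂ refl = All-Apart⇒avoids e-apart w∈e

        v∉e′∷R : ¬ Any (Endpoint v) (e′ ∷ ys ++ zs)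
        v∉e′∷R (here v∈e′) with e′-ends v∈e′
        ... | inj₁ refl = adj⇒≢ uv refl
        ... | inj₂ refl = adj⇒≢ vw refl
        v∉e′∷R (there v∈R) = All-Apart⇒avoids e-apart v∈e v∈R

      GE-A-empty : ∀ v → GE-A G v ≡ false
      GE-A-empty v = to T-not-≡ (from T-not⇔¬T λ t →
        let v∉D , ∃u = to (T-∧ {not (GE-D G v)}) t
            u , _ , tu = find (from (any⇔ {xs = allFin n} {p = λ u → GE-D G u ∧ adj G u v}) ∃u)
            u∈D , uv = to (T-∧ {GE-D G u}) tu
        in to T-not⇔¬T v∉D
             (from (T-GE-D⇔ {v}) (missing-spreads (to (T-GE-D⇔ {u}) u∈D) (to T-≡ uv))))

open import Data.Nat using (ℕ)
open import Data.Product using (_×_)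
open import Data.Fin.Subset using (Subset; ⊥; Nonempty)
open import Data.Integer using (+_; _<_)

open import Data.Nat as ℕ using (z≤n)
open import Data.Nat.Properties using (m<n⇒0<n∸m)
open import Data.Fin.Subset using (∣_∣; _∩_)
open import Data.Fin.Subset.Properties using (nonempty?; Empty-unique; ∣⊥∣≡0; ∩-zeroʳ)
open import Data.Integer as ℤ using (_-_; _≤_; +<+)
open import Data.Integer.Properties using (⊖-<; m-n≡m⊖n; neg-mono-<; <⇒≤; ≤-refl; +-identityʳ)
open import Data.List using (map; allFin)
open import Data.List.Properties using (map-∘)
open import Data.Product using (_,_; proj₁)
open import Relation.Binary.PropositionalEquality using (_≡_; sym; trans; cong; cong₂; subst)
open import Relation.Nullary using (yes; no)
open SubsetFacts using (toSubset-false)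
open Hyperforests using (pairs; pairs-small; pairs<∣S∣; sumℕ-zero)
open Matchings using (GE-A-empty)

+m-+n<0 : ∀ {m n} → m ℕ.< n → + m - + n < + 0
+m-+n<0 {m} {n} m<n =
  subst (_< + 0) (sym (trans (m-n≡m⊖n m n) (⊖-< m<n))) (neg-mono-< (+<+ (m<n⇒0<n∸m m<n)))

module _ {n q} (𝒢 : Colouring n q) where

  σ-of-D-complete : D-complete 𝒢 → ∀ S → σ 𝒢 S ≡ + pairs (𝒦 𝒢) S - + ∣ S ∣
  σ-of-D-complete complete S =
    trans (cong (λ a → (+ pairs (𝒦 𝒢) S ℤ.+ + a) - + ∣ S ∣) A-part≡0)
          (cong (_- + ∣ S ∣) (+-identityʳ (+ pairs (𝒦 𝒢) S)))
    where
    A-part≡0 : sumℕ (map (λ A → ∣ S ∩ A ∣) (𝒜 𝒢)) ≡ 0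
    A-part≡0 = trans (cong sumℕ (sym (map-∘ (allFin q)))) (sumℕ-zero _ (allFin q) λ j →
      trans (cong (λ A → ∣ S ∩ A ∣) (toSubset-false (GE-A-empty (Gc 𝒢 j) (proj₁ (complete j)))))
            (trans (cong ∣_∣ (∩-zeroʳ S)) (∣⊥∣≡0 n)))

  σ⊥≡0 : D-complete 𝒢 → σ 𝒢 ⊥ ≡ + 0
  σ⊥≡0 complete =
    trans (σ-of-D-complete complete ⊥)
          (cong₂ (λ a b → + a - + b) (pairs-small (𝒦 𝒢) ⊥ ∣⊥∣≤1) (∣⊥∣≡0 n))
    where
    ∣⊥∣≤1 : ∣ ⊥ {n} ∣ ℕ.≤ 1
    ∣⊥∣≤1 = subst (ℕ._≤ 1) (sym (∣⊥∣≡0 n)) z≤n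

  σ<0 : D-acyclic 𝒢 → ∀ S → Nonempty S → σ 𝒢 S < + 0
  σ<0 (complete , forest) S ne =
    subst (_< + 0) (sym (σ-of-D-complete complete S)) (+m-+n<0 (pairs<∣S∣ (𝒦 𝒢) forest S ne))

  ⊥-σ-maximal : (∀ S → Nonempty S → σ 𝒢 S < σ 𝒢 ⊥) → σ-maximal 𝒢 ⊥
  ⊥-σ-maximal σ<σ⊥ = σ≤σ⊥ , λ { T (_ , x , x∈T , _) → σ<σ⊥ T (x , x∈T) }
    where
    σ≤σ⊥ : ∀ S → σ 𝒢 S ≤ σ 𝒢 ⊥
    σ≤σ⊥ S with nonempty? S
    ... | yes ne    = <⇒≤ (σ<σ⊥ S ne)
    ... | no  empty rewrite Empty-unique empty = ≤-refl

lemma3p2 : (n q : ℕ) (𝒢 : Colouring n q) → D-acyclic 𝒢 →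
    σ-maximal 𝒢 ⊥ × ((S : Subset n) → Nonempty S → σ 𝒢 S < + 0)
lemma3p2 n q 𝒢 acyclic@(complete , _) =
  ⊥-σ-maximal 𝒢 (λ S ne → subst (σ 𝒢 S <_) (sym (σ⊥≡0 𝒢 complete)) (σ<0 𝒢 acyclic S ne)) ,
  σ<0 𝒢 acyclic
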